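{- Let $A\subset\mathbb{N}^*$ be a nonempty finite subset. Then $C(u_A)=\textbf{red}$ if and only if $A$ is an interval, where $C$ is the coloring described in the context.
   Context: Alphabet $\{x_1,x_2,\ldots\}$; $Z_1=x_1$, $Z_{m+1}=Z_mx_{m+1}Z_m$, $Z=\lim Z_m$. For a factor $u$ of $Z$, $k(u)=\max\{k:x_k\text{ occurs in }u\}$. $u_1=v_1=x_1$, $u_{m+1}=x_{m+1}u_1\cdots u_m$, $v_{m+1}=v_m\cdots v_1x_{m+1}$; $[a,b[=\{a,\ldots,b-1\}$; for finite $A=\{i_1<\cdots<i_k\}$, $u_A=u_{i_1}\cdots u_{i_k}$ and for $B=\{j_1<\cdots<j_k\}$, $v_B=v_{j_k}\cdots v_{j_1}$ (empty products are empty). Every factor $u$ of $Z$ is uniquely $u=u_Ax_{k(u)}v_B$ with $A,B\subset[1,k(u)[$; in this writing set $\eta(u)=\max([1,k(u)[\setminus A)$, with $\eta(u)=0$ if $A=[1,k(u)[$. For factors $u$ of $Z$: $C(u)=\textbf{red}$ if $A\cap[1,\eta(u)[=[1,\eta(u)[\setminus(B\cap[1,\eta(u)[)$, and $C(u)=\textbf{blue}$ otherwise. (Each $u_A$ is a factor of $Z$.) An interval is a set $\{k,\ldots,l\}$ of consecutive integers. -}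

module Defs where

open import Data.Nat using (ℕ; zero; suc; _⊔_; _∸_; _≤_; _<_)
open import Data.Bool using (Bool; true; false; if_then_else_; not)
open import Data.List using (List; []; _∷_; _++_; [_]; foldr; concat; map; upTo; reverse)
open import Data.List.Relation.Unary.All using (All)
open import Data.List.Relation.Unary.Linked using (Linked)
open import Data.List.Membership.Propositional using (_∈_)
open import Data.Product using (Σ; _×_; ∃)
open import Function.Bundles using (_⇔_)
open import Relation.Binary.PropositionalEquality using (_≡_)

-- Words over the alphabet {x_1, x_2, ...}: letter x_k is the natural number k.
Word : Set
Word = List ℕ

Zimin : ℕ → Word
Zimin zero = []
Zimin (suc m) = Zimin m ++ (suc m ∷ Zimin m)

mutual
  u : ℕ → Word
  u zero = []                      -- u_0 unused (convention)
  u (suc m) = suc m ∷ prodU m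

  prodU : ℕ → Word
  prodU zero = []
  prodU (suc m) = prodU m ++ u (suc m)

mutual
  v : ℕ → Word
  v zero = []                      -- v_0 unused (convention)
  v (suc m) = prodV m ++ [ suc m ]

  prodV : ℕ → Word
  prodV zero = []
  prodV (suc m) = v (suc m) ++ prodV m

kmax : Word → ℕ
kmax = foldr _⊔_ 0

-- finite subsets of ℕ* given as strictly increasing lists of positive integers
IsFinSubsetPos : List ℕ → Set
IsFinSubsetPos A = All (λ i → 1 ≤ i) A × Linked _<_ A

uL : List ℕ → Word
uL A = concat (map u A)

range1 : ℕ → List ℕ
range1 k = map suc (upTo (k ∸ 1))

select : (ℕ → Bool) → List ℕ → List ℕ
select P [] = []
select P (x ∷ xs) = if P x then x ∷ select P xs else select P xs

-- For a subset S ⊆ [1,k[ given by a Boolean predicate: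
-- u_S (increasing product) and v_S (decreasing product)
uSub : ℕ → (ℕ → Bool) → Word
uSub k S = concat (map u (select S (range1 k)))

vSub : ℕ → (ℕ → Bool) → Word
vSub k S = concat (map v (reverse (select S (range1 k))))

eta : ℕ → (ℕ → Bool) → ℕ
eta k A = foldr _⊔_ 0 (select (λ i → not (A i)) (range1 k))

RedCond : ℕ → (ℕ → Bool) → (ℕ → Bool) → Set
RedCond k A B = ∀ i → 1 ≤ i → i < eta k A → (A i ≡ true ⇔ B i ≡ false)

-- C(w) = red: the (unique) decomposition w = u_A x_{k(w)} v_B with A, B ⊆ [1,k(w)[
-- satisfies the red condition.  (Only membership in [1,k(w)[ of A, B matters.)
IsRed : Word → Set
IsRed w = Σ (ℕ → Bool) λ A → Σ (ℕ → Bool) λ B →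
            (w ≡ uSub (kmax w) A ++ (kmax w ∷ vSub (kmax w) B)) × RedCond (kmax w) A B

IsInterval : List ℕ → Set
IsInterval A = ∃ λ k → ∃ λ l → ∀ i → (i ∈ A ⇔ (k ≤ i × i ≤ l))

-- Write A = xs ∪ {m+1} with m+1 = max A. Then u_A = u_xs x_{m+1} u_1 ⋯ u_m, and u_1 ⋯ u_m
-- (the Zimin word Z_m) is a palindrome equal to v_m ⋯ v_1, so the decomposition of u_A is
-- forced: its u-part is xs and its v-part is all of [1, m+1[. With B full, the red condition
-- says that no element of xs lies below η, the largest gap of xs in [1, m+1[; and this is
-- exactly the statement that A = ]η, m+1] is an interval.
module Submission where

open import Defs
open import Data.List using (List; [])
open import Data.Nat using (ℕ)
open import Function.Bundles using (_⇔_)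
open import Relation.Binary.PropositionalEquality using (_≢_)

open import Function using (_∘_)
open import Function.Bundles using (mk⇔; module Equivalence)
open import Data.Bool using (Bool; true; false; not)
open import Data.Bool.Properties using (T-≡; T-not-≡)
open import Data.Nat using (suc; zero; _≤_; _<_; z≤n; s≤s; s≤s⁻¹)
open import Data.Nat.Properties
  using (≤-refl; ≤-trans; ≤-antisym; <⇒≤; <⇒≢; <⇒≱; <-irrefl; <-trans; <-cmp;
         m≤n⇒m≤1+n; m≤n⇒m<n∨m≡n; ⊔-lub; ⊔-sel; m≤m⊔n; m≤n⊔m)
open import Data.Product using (Σ; _×_; _,_; proj₁; proj₂)
open import Data.Sum using (_⊎_; inj₁; inj₂)
open import Data.List
  using (_∷_; _++_; _∷ʳ_; [_]; concat; map; reverse; filterᵇ; upTo; initLast; _∷ʳ′_)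
open import Data.List.Properties
  using (∷-injective; ∷-injectiveˡ; ∷-injectiveʳ; ++-assoc; ++-identityʳ; ++-cancelˡ;
         map-++; concat-++; unfold-reverse; reverse-++; reverse-involutive; upTo-∷ʳ)
open import Data.List.Relation.Unary.All using (All; []; _∷_; lookup)
import Data.List.Relation.Unary.All as All
import Data.List.Relation.Unary.All.Properties as All
open import Data.List.Relation.Unary.AllPairs using (AllPairs; []; _∷_)
import Data.List.Relation.Unary.AllPairs.Properties as AllPairs
open import Data.List.Relation.Unary.Linked.Properties using (Linked⇒AllPairs)
open import Data.List.Relation.Unary.Any using (here; there)
open import Data.List.Membership.Propositional using (_∈_; _∉_)
open import Data.List.Membership.Propositional.Properties
  using (∈-++⁻; ∈-++⁺ˡ; ∈-++⁺ʳ; ∈-map⁺; ∈-map⁻; ∈-upTo⁺; ∈-upTo⁻; ∈-filter⁺; ∈-filter⁻)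
open import Data.List.Membership.DecPropositional Data.Nat._≟_ using (_∈?_)
open import Relation.Binary.Core using (Rel)
open import Relation.Binary.Definitions using (tri<; tri≈; tri>)
open import Relation.Binary.PropositionalEquality
  using (_≡_; refl; sym; trans; cong; cong₂; subst; _≗_; module ≡-Reasoning)
open import Relation.Nullary using (contradiction)
open import Relation.Nullary.Decidable using (T?; isYes; toWitness; fromWitness)

open Equivalence using (to; from)
open ≡-Reasoning

concat-map-∷ʳ : ∀ {a b} {X : Set a} {Y : Set b} (f : X → List Y) xs x →
                concat (map f (xs ∷ʳ x)) ≡ concat (map f xs) ++ f x
concat-map-∷ʳ f xs x = begin
  concat (map f (xs ++ [ x ]))      ≡⟨ cong concat (map-++ f xs [ x ]) ⟩
  concat (map f xs ++ [ f x ])      ≡⟨ concat-++ (map f xs) [ f x ] ⟨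
  concat (map f xs) ++ (f x ++ [])  ≡⟨ cong (concat (map f xs) ++_) (++-identityʳ (f x)) ⟩
  concat (map f xs) ++ f x          ∎

++-∷-cancel : ∀ {a} {X : Set a} {x : X} xs ys xs′ ys′ → All (_≢ x) xs → All (_≢ x) xs′ →
              xs ++ x ∷ ys ≡ xs′ ++ x ∷ ys′ → xs ≡ xs′ × ys ≡ ys′
++-∷-cancel [] ys [] ys′ _ _ eq = refl , ∷-injectiveʳ eq
++-∷-cancel [] ys (y ∷ xs′) ys′ _ (y≢x ∷ _) eq = contradiction (sym (∷-injectiveˡ eq)) y≢x
++-∷-cancel (y ∷ xs) ys [] ys′ (y≢x ∷ _) _ eq = contradiction (∷-injectiveˡ eq) y≢x
++-∷-cancel (y ∷ xs) ys (_ ∷ xs′) ys′ (_ ∷ xs≢x) (_ ∷ xs′≢x) eq with ∷-injective eq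
... | refl , eq′ with ++-∷-cancel xs ys xs′ ys′ xs≢x xs′≢x eq′
...   | xs≡xs′ , ys≡ys′ = cong (y ∷_) xs≡xs′ , ys≡ys′

AllPairs-∷ʳ⁻ : ∀ {a ℓ} {X : Set a} {R : Rel X ℓ} xs {x} →
               AllPairs R (xs ∷ʳ x) → AllPairs R xs × All (λ y → R y x) xs
AllPairs-∷ʳ⁻ [] _ = [] , []
AllPairs-∷ʳ⁻ (y ∷ xs) (Ry ∷ R-xs) with All.∷ʳ⁻ Ry | AllPairs-∷ʳ⁻ xs R-xs
... | Ry-xs , Ryx | xs-pairs , xs-x = (Ry-xs ∷ xs-pairs) , (Ryx ∷ xs-x)

AllPairs-<-≡ : ∀ {xs ys} → AllPairs _<_ xs → AllPairs _<_ ys →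
               (∀ {i} → i ∈ xs ⇔ i ∈ ys) → xs ≡ ys
AllPairs-<-≡ {[]} {[]} _ _ _ = refl
AllPairs-<-≡ {[]} {_ ∷ _} _ _ same with () ← from same (here refl)
AllPairs-<-≡ {_ ∷ _} {[]} _ _ same with () ← to same (here refl)
AllPairs-<-≡ {x ∷ xs} {y ∷ ys} (x< ∷ xs↗) (y< ∷ ys↗) same =
  cong₂ _∷_ x≡y (AllPairs-<-≡ xs↗ ys↗
                   (mk⇔ (drop x≡y x< (to same)) (drop (sym x≡y) y< (from same))))
  where
  head≤ : ∀ {z zs w} → All (z <_) zs → w ∈ z ∷ zs → z ≤ w
  head≤ _ (here refl) = ≤-refl
  head≤ z< (there w∈) = <⇒≤ (lookup z< w∈)

  x≡y : x ≡ y
  x≡y = ≤-antisym (head≤ x< (from same (here refl))) (head≤ y< (to same (here refl)))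

  drop : ∀ {z zs w ws} → z ≡ w → All (z <_) zs →
         (∀ {i} → i ∈ z ∷ zs → i ∈ w ∷ ws) → ∀ {i} → i ∈ zs → i ∈ ws
  drop z≡w z< f i∈ with f (there i∈)
  ... | here refl = contradiction (lookup z< i∈) (<-irrefl z≡w)
  ... | there i∈ws = i∈ws

select≗filterᵇ : ∀ P → select P ≗ filterᵇ P
select≗filterᵇ P [] = refl
select≗filterᵇ P (x ∷ xs) with P x
... | true  = cong (x ∷_) (select≗filterᵇ P xs)
... | false = select≗filterᵇ P xs

∈-select : ∀ P xs {i} → i ∈ select P xs ⇔ (i ∈ xs × P i ≡ true)
∈-select P xs = mk⇔
  (λ i∈ → let i∈xs , Pi = ∈-filter⁻ (T? ∘ P) (subst (_ ∈_) (select≗filterᵇ P xs) i∈)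
          in i∈xs , to T-≡ Pi)
  (λ (i∈xs , Pi) → subst (_ ∈_) (sym (select≗filterᵇ P xs))
                         (∈-filter⁺ (T? ∘ P) i∈xs (from T-≡ Pi)))

select-true : ∀ xs → select (λ _ → true) xs ≡ xs
select-true [] = refl
select-true (x ∷ xs) = cong (x ∷_) (select-true xs)

AllPairs-select : ∀ {ℓ} {R : Rel ℕ ℓ} P {xs} → AllPairs R xs → AllPairs R (select P xs)
AllPairs-select P {xs} R-xs =
  subst (AllPairs _) (sym (select≗filterᵇ P xs)) (AllPairs.filter⁺ (T? ∘ P) R-xs)

∈-range1 : ∀ m {i} → i ∈ range1 (suc m) ⇔ (1 ≤ i × i ≤ m)
∈-range1 m = mk⇔ bounds member
  where
  bounds : ∀ {i} → i ∈ map suc (upTo m) → 1 ≤ i × i ≤ m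
  bounds i∈ with _ , j∈ , refl ← ∈-map⁻ suc i∈ = s≤s z≤n , ∈-upTo⁻ j∈
  member : ∀ {i} → 1 ≤ i × i ≤ m → i ∈ map suc (upTo m)
  member (s≤s z≤n , i≤m) = ∈-map⁺ suc (∈-upTo⁺ i≤m)

∈-select-range1 : ∀ m P {i} → i ∈ select P (range1 (suc m)) ⇔ (1 ≤ i × i ≤ m × P i ≡ true)
∈-select-range1 m P = mk⇔
  (λ i∈ → let i∈R , Pi = to (∈-select P _) i∈
              1≤i , i≤m = to (∈-range1 m) i∈R
          in 1≤i , i≤m , Pi)
  (λ (1≤i , i≤m , Pi) → from (∈-select P _) (from (∈-range1 m) (1≤i , i≤m) , Pi))

range1-∷ʳ : ∀ m → range1 (suc (suc m)) ≡ range1 (suc m) ∷ʳ suc m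
range1-∷ʳ m = trans (cong (map suc) (sym (upTo-∷ʳ m))) (map-++ suc (upTo m) [ m ])

range1-sorted : ∀ m → AllPairs _<_ (range1 (suc m))
range1-sorted m = AllPairs.map⁺ (AllPairs.applyUpTo⁺₁ (λ i → i) m (λ i<j _ → s≤s i<j))

∈⇒≤kmax : ∀ {x} w → x ∈ w → x ≤ kmax w
∈⇒≤kmax (y ∷ w) (here refl) = m≤m⊔n y (kmax w)
∈⇒≤kmax (y ∷ w) (there x∈) = ≤-trans (∈⇒≤kmax w x∈) (m≤n⊔m y (kmax w))

kmax≤ : ∀ {n w} → All (_≤ n) w → kmax w ≤ n
kmax≤ [] = z≤n
kmax≤ (y≤n ∷ w≤n) = ⊔-lub y≤n (kmax≤ w≤n)

kmax-sel : ∀ w → kmax w ≡ 0 ⊎ kmax w ∈ w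
kmax-sel [] = inj₁ refl
kmax-sel (y ∷ w) with ⊔-sel y (kmax w) | kmax-sel w
... | inj₁ max≡y    | _           = inj₂ (here max≡y)
... | inj₂ max≡rest | inj₁ rest≡0 = inj₁ (trans max≡rest rest≡0)
... | inj₂ max≡rest | inj₂ rest∈w = inj₂ (there (subst (_∈ w) (sym max≡rest) rest∈w))

eta≤ : ∀ m P → eta (suc m) P ≤ m
eta≤ m P = kmax≤ (All.tabulate (proj₁ ∘ proj₂ ∘ to (∈-select-range1 m (not ∘ P))))

gap≤eta : ∀ m P {i} → 1 ≤ i → i ≤ m → P i ≡ false → i ≤ eta (suc m) P
gap≤eta m P 1≤i i≤m Pi =
  ∈⇒≤kmax _ (from (∈-select-range1 m (not ∘ P)) (1≤i , i≤m , cong not Pi))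

eta-gap : ∀ m P → 1 ≤ eta (suc m) P → P (eta (suc m) P) ≡ false
eta-gap m P 1≤η with kmax-sel (select (not ∘ P) (range1 (suc m)))
... | inj₁ η≡0 = contradiction (subst (1 ≤_) η≡0 1≤η) λ ()
... | inj₂ η∈ = to T-not-≡ (from T-≡ (proj₂ (proj₂ (to (∈-select-range1 m (not ∘ P)) η∈))))

prodU-bound : ∀ m → All (_≤ m) (prodU m)
prodU-bound zero = []
prodU-bound (suc m) = All.++⁺ below (≤-refl ∷ below)
  where below = All.map m≤n⇒m≤1+n (prodU-bound m)

u-bound : ∀ j → All (_≤ j) (u j)
u-bound zero = []
u-bound (suc m) = ≤-refl ∷ All.map m≤n⇒m≤1+n (prodU-bound m)

uL-bound : ∀ {n xs} → All (_≤ n) xs → All (_≤ n) (uL xs)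
uL-bound = All.concat⁺ ∘ All.map⁺ ∘
           All.map (λ {j} j≤n → All.map (λ k≤j → ≤-trans k≤j j≤n) (u-bound j))

uL-injective : ∀ {xs ys} → All (1 ≤_) xs → All (1 ≤_) ys → uL xs ≡ uL ys → xs ≡ ys
uL-injective [] [] _ = refl
uL-injective [] (s≤s z≤n ∷ _) ()
uL-injective (s≤s z≤n ∷ _) [] ()
uL-injective {suc i ∷ _} (s≤s z≤n ∷ xs⁺) (s≤s z≤n ∷ ys⁺) eq with ∷-injective eq
... | refl , eq′ = cong (suc i ∷_) (uL-injective xs⁺ ys⁺ (++-cancelˡ (prodU i) _ _ eq′))

reverse-prodU : ∀ m → reverse (prodU m) ≡ prodU m
reverse-prodU zero = refl
reverse-prodU (suc m) = begin
  reverse (prodU m ++ suc m ∷ prodU m)            ≡⟨ reverse-++ (prodU m) (suc m ∷ prodU m) ⟩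
  reverse (suc m ∷ prodU m) ++ reverse (prodU m)  ≡⟨ cong₂ _++_ (unfold-reverse (suc m) (prodU m))
                                                                (reverse-prodU m) ⟩
  (reverse (prodU m) ∷ʳ suc m) ++ prodU m         ≡⟨ cong (λ w → (w ∷ʳ suc m) ++ prodU m)
                                                          (reverse-prodU m) ⟩
  (prodU m ∷ʳ suc m) ++ prodU m                   ≡⟨ ++-assoc (prodU m) [ suc m ] (prodU m) ⟩
  prodU m ++ suc m ∷ prodU m                      ∎

mutual
  v≡reverse-u : ∀ j → v j ≡ reverse (u j)
  v≡reverse-u zero = refl
  v≡reverse-u (suc m) =
    trans (cong (_∷ʳ suc m) (prodV≡reverse-prodU m)) (sym (unfold-reverse (suc m) (prodU m)))

  prodV≡reverse-prodU : ∀ m → prodV m ≡ reverse (prodU m)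
  prodV≡reverse-prodU zero = refl
  prodV≡reverse-prodU (suc m) =
    trans (cong₂ _++_ (v≡reverse-u (suc m)) (prodV≡reverse-prodU m))
          (sym (reverse-++ (prodU m) (u (suc m))))

vL≡reverse-uL : ∀ xs → concat (map v (reverse xs)) ≡ reverse (uL xs)
vL≡reverse-uL [] = refl
vL≡reverse-uL (x ∷ xs) = begin
  concat (map v (reverse (x ∷ xs)))   ≡⟨ cong (concat ∘ map v) (unfold-reverse x xs) ⟩
  concat (map v (reverse xs ∷ʳ x))    ≡⟨ concat-map-∷ʳ v (reverse xs) x ⟩
  concat (map v (reverse xs)) ++ v x  ≡⟨ cong₂ _++_ (vL≡reverse-uL xs) (v≡reverse-u x) ⟩
  reverse (uL xs) ++ reverse (u x)    ≡⟨ reverse-++ (u x) (uL xs) ⟨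
  reverse (u x ++ uL xs)              ∎

uL-range1 : ∀ m → uL (range1 (suc m)) ≡ prodU m
uL-range1 zero = refl
uL-range1 (suc m) = begin
  uL (range1 (suc (suc m)))               ≡⟨ cong uL (range1-∷ʳ m) ⟩
  uL (range1 (suc m) ∷ʳ suc m)            ≡⟨ concat-map-∷ʳ u (range1 (suc m)) (suc m) ⟩
  uL (range1 (suc m)) ++ suc m ∷ prodU m  ≡⟨ cong (_++ suc m ∷ prodU m) (uL-range1 m) ⟩
  prodU (suc m)                           ∎

vSub-true : ∀ m → vSub (suc m) (λ _ → true) ≡ prodU m
vSub-true m = begin
  concat (map v (reverse (select (λ _ → true) R)))
    ≡⟨ cong (concat ∘ map v ∘ reverse) (select-true R) ⟩
  concat (map v (reverse R))  ≡⟨ vL≡reverse-uL R ⟩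
  reverse (uL R)              ≡⟨ cong reverse (uL-range1 m) ⟩
  reverse (prodU m)           ≡⟨ reverse-prodU m ⟩
  prodU m                     ∎
  where R = range1 (suc m)

vSub≡prodU⇒full : ∀ m B → vSub (suc m) B ≡ prodU m →
                  select B (range1 (suc m)) ≡ range1 (suc m)
vSub≡prodU⇒full m B eq =
  uL-injective (All.tabulate (proj₁ ∘ to (∈-select-range1 m B)))
               (All.tabulate (proj₁ ∘ to (∈-range1 m)))
               (begin
    uL S                      ≡⟨ reverse-involutive (uL S) ⟨
    reverse (reverse (uL S))  ≡⟨ cong reverse (vL≡reverse-uL S) ⟨
    reverse (vSub (suc m) B)  ≡⟨ cong reverse eq ⟩
    reverse (prodU m)         ≡⟨ reverse-prodU m ⟩
    prodU m                   ≡⟨ uL-range1 m ⟨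
    uL R                      ∎)
  where
  R = range1 (suc m)
  S = select B R

-- IsRed w is definitionally IsRedAt (kmax w) w.
IsRedAt : ℕ → Word → Set
IsRedAt k w = Σ (ℕ → Bool) λ P → Σ (ℕ → Bool) λ B →
                (w ≡ uSub k P ++ (k ∷ vSub k B)) × RedCond k P B

kmax-uL-∷ʳ : ∀ {m xs} → All (_≤ m) xs → kmax (uL (xs ∷ʳ suc m)) ≡ suc m
kmax-uL-∷ʳ {m} {xs} xs≤m =
  ≤-antisym (kmax≤ (uL-bound (All.∷ʳ⁺ (All.map m≤n⇒m≤1+n xs≤m) ≤-refl))) (∈⇒≤kmax _ top∈)
  where
  top∈ : suc m ∈ uL (xs ∷ʳ suc m)
  top∈ = subst (suc m ∈_) (sym (concat-map-∷ʳ u xs (suc m))) (∈-++⁺ʳ (uL xs) (here refl))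

decomposition-unique : ∀ {m xs} P B → All (1 ≤_) xs → All (_≤ m) xs →
                       uL (xs ∷ʳ suc m) ≡ uSub (suc m) P ++ suc m ∷ vSub (suc m) B →
                       xs ≡ select P (range1 (suc m)) × select B (range1 (suc m)) ≡ range1 (suc m)
decomposition-unique {m} {xs} P B xs⁺ xs≤m eq =
  uL-injective xs⁺ (All.map proj₁ S-bounds) (proj₁ split) ,
  vSub≡prodU⇒full m B (sym (proj₂ split))
  where
  S-bounds : All (λ i → 1 ≤ i × i ≤ m × P i ≡ true) (select P (range1 (suc m)))
  S-bounds = All.tabulate (to (∈-select-range1 m P))

  below-top : ∀ {ys} → All (_≤ m) ys → All (_≢ suc m) (uL ys)
  below-top = All.map (<⇒≢ ∘ s≤s) ∘ uL-bound

  split : uL xs ≡ uSub (suc m) P × prodU m ≡ vSub (suc m) B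
  split = ++-∷-cancel (uL xs) (prodU m) (uSub (suc m) P) (vSub (suc m) B)
                      (below-top xs≤m) (below-top (All.map (proj₁ ∘ proj₂) S-bounds))
                      (trans (sym (concat-map-∷ʳ u xs (suc m))) eq)

decomposition-exists : ∀ m P → uL (select P (range1 (suc m)) ∷ʳ suc m) ≡
                               uSub (suc m) P ++ suc m ∷ vSub (suc m) (λ _ → true)
decomposition-exists m P =
  trans (concat-map-∷ʳ u (select P (range1 (suc m))) (suc m))
        (cong (λ w → uSub (suc m) P ++ suc m ∷ w) (sym (vSub-true m)))

interval⇔no-member-below-eta : ∀ m P →
  IsInterval (select P (range1 (suc m)) ∷ʳ suc m) ⇔
  (∀ i → 1 ≤ i → i < eta (suc m) P → P i ≢ true)
interval⇔no-member-below-eta m P = mk⇔ no-member-below interval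
  where
  S = select P (range1 (suc m))
  η = eta (suc m) P

  ∈S : ∀ {i} → 1 ≤ i → i ≤ m → P i ≡ true → i ∈ S ∷ʳ suc m
  ∈S 1≤i i≤m Pi = ∈-++⁺ˡ (from (∈-select-range1 m P) (1≤i , i≤m , Pi))

  top∈ : suc m ∈ S ∷ʳ suc m
  top∈ = ∈-++⁺ʳ S (here refl)

  ∈⁻ : ∀ {i} → i ∈ S ∷ʳ suc m → (1 ≤ i × i ≤ m × P i ≡ true) ⊎ i ≡ suc m
  ∈⁻ i∈ with ∈-++⁻ S i∈
  ... | inj₁ i∈S = inj₁ (to (∈-select-range1 m P) i∈S)
  ... | inj₂ (here i≡top) = inj₂ i≡top

  no-member-below : IsInterval (S ∷ʳ suc m) → ∀ i → 1 ≤ i → i < η → P i ≢ true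
  no-member-below (k , l , iv) i 1≤i i<η Pi = η∉ (from (iv η) (k≤η , η≤l))
    where
    k≤η = ≤-trans (proj₁ (to (iv i) (∈S 1≤i (≤-trans (<⇒≤ i<η) (eta≤ m P)) Pi))) (<⇒≤ i<η)
    η≤l = ≤-trans (m≤n⇒m≤1+n (eta≤ m P)) (proj₂ (to (iv (suc m)) top∈))

    η∉ : η ∉ S ∷ʳ suc m
    η∉ η∈ with ∈⁻ η∈
    ... | inj₁ (_ , _ , Pη) =
      contradiction (trans (sym Pη) (eta-gap m P (≤-trans 1≤i (<⇒≤ i<η)))) λ ()
    ... | inj₂ η≡top = contradiction (eta≤ m P) (<⇒≱ (subst (m <_) (sym η≡top) ≤-refl))

  interval : (∀ i → 1 ≤ i → i < η → P i ≢ true) → IsInterval (S ∷ʳ suc m)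
  interval none-below = suc η , suc m , λ i → mk⇔ inside member
    where
    η<member : ∀ {i} → 1 ≤ i → P i ≡ true → η < i
    η<member {i} 1≤i Pi with <-cmp i η
    ... | tri< i<η _ _  = contradiction Pi (none-below i 1≤i i<η)
    ... | tri≈ _ refl _ = contradiction (trans (sym Pi) (eta-gap m P 1≤i)) λ ()
    ... | tri> _ _ η<i  = η<i

    inside : ∀ {i} → i ∈ S ∷ʳ suc m → suc η ≤ i × i ≤ suc m
    inside i∈ with ∈⁻ i∈
    ... | inj₁ (1≤i , i≤m , Pi) = η<member 1≤i Pi , m≤n⇒m≤1+n i≤m
    ... | inj₂ refl = s≤s (eta≤ m P) , ≤-refl

    member : ∀ {i} → suc η ≤ i × i ≤ suc m → i ∈ S ∷ʳ suc m
    member {i} (η<i , i≤1+m) with m≤n⇒m<n∨m≡n i≤1+m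
    ... | inj₂ refl = top∈
    ... | inj₁ i<1+m with P i in Pi
    ...   | true  = ∈S (≤-trans (s≤s z≤n) η<i) (s≤s⁻¹ i<1+m) Pi
    ...   | false = contradiction (gap≤eta m P (≤-trans (s≤s z≤n) η<i) (s≤s⁻¹ i<1+m) Pi)
                                  (<⇒≱ η<i)

redAt⇔interval : ∀ {m xs} → All (1 ≤_) xs → AllPairs _<_ xs → All (_≤ m) xs →
                 IsRedAt (suc m) (uL (xs ∷ʳ suc m)) ⇔ IsInterval (xs ∷ʳ suc m)
redAt⇔interval {m} {xs} xs⁺ xs↗ xs≤m = mk⇔ interval red
  where
  R = range1 (suc m)

  interval : IsRedAt (suc m) (uL (xs ∷ʳ suc m)) → IsInterval (xs ∷ʳ suc m)
  interval (P , B , eq , rc) with decomposition-unique P B xs⁺ xs≤m eq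
  ... | xs≡S , B-full = subst (λ ys → IsInterval (ys ∷ʳ suc m)) (sym xs≡S)
                          (from (interval⇔no-member-below-eta m P) none-below)
    where
    none-below : ∀ i → 1 ≤ i → i < eta (suc m) P → P i ≢ true
    none-below i 1≤i i<η Pi = contradiction (trans (sym Bi) (to (rc i 1≤i i<η) Pi)) λ ()
      where
      i∈R = from (∈-range1 m) (1≤i , ≤-trans (<⇒≤ i<η) (eta≤ m P))
      Bi = proj₂ (to (∈-select B R) (subst (i ∈_) (sym B-full) i∈R))

  red : IsInterval (xs ∷ʳ suc m) → IsRedAt (suc m) (uL (xs ∷ʳ suc m))
  red iv = P , (λ _ → true) ,
           subst (λ ys → uL (ys ∷ʳ suc m) ≡ uSub (suc m) P ++ suc m ∷ vSub (suc m) (λ _ → true))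
                 (sym xs≡S) (decomposition-exists m P) ,
           λ i 1≤i i<η → mk⇔ (λ Pi → contradiction Pi (none-below i 1≤i i<η)) λ ()
    where
    P : ℕ → Bool
    P i = isYes (i ∈? xs)

    same-members : ∀ {i} → i ∈ xs ⇔ i ∈ select P R
    same-members = mk⇔
      (λ i∈ → from (∈-select-range1 m P)
                   (lookup xs⁺ i∈ , lookup xs≤m i∈ , to T-≡ (fromWitness i∈)))
      (λ i∈ → toWitness (from T-≡ (proj₂ (proj₂ (to (∈-select-range1 m P) i∈)))))

    xs≡S : xs ≡ select P R
    xs≡S = AllPairs-<-≡ xs↗ (AllPairs-select P (range1-sorted m)) same-members

    none-below : ∀ i → 1 ≤ i → i < eta (suc m) P → P i ≢ true
    none-below = to (interval⇔no-member-below-eta m P)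
                    (subst (λ ys → IsInterval (ys ∷ʳ suc m)) xs≡S iv)

proposition10 : (A : List ℕ) → IsFinSubsetPos A → A ≢ [] →
    (IsRed (uL A) ⇔ IsInterval A)
proposition10 A (A⁺ , A↗) A≢[] with initLast A
... | [] = contradiction refl A≢[]
... | xs ∷ʳ′ _ with All.∷ʳ⁻ A⁺ | AllPairs-∷ʳ⁻ xs (Linked⇒AllPairs <-trans A↗)
...   | xs⁺ , s≤s {n = m} z≤n | xs↗ , xs<top =
  subst (λ k → IsRedAt k (uL (xs ∷ʳ suc m)) ⇔ IsInterval (xs ∷ʳ suc m))
        (sym (kmax-uL-∷ʳ xs≤m)) (redAt⇔interval xs⁺ xs↗ xs≤m)
  where
  xs≤m : All (_≤ m) xs
  xs≤m = All.map s≤s⁻¹ xs<top
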